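{- Fix $L\ge1$. (a) $(2^\omega,(g_n^L|_{\mathbb{D}_n^L})_{n\in\omega})$ is a strongly complex situation. (b) If $s\in\omega^{<\omega}$ is strictly increasing with $2\le|s|\le L$, $\alpha\in\mathbb{D}^L_{s(|s|-1)}$, and $g_s(\alpha)$, $g_{s^- }(\alpha)$ are defined, then $g_s(\alpha)\ne g_{s^- }(\alpha)$. (c) If $s\in\omega^{<\omega}$ is strictly increasing with $|s|=L+1$ and $g_s(\alpha)$, $g_{s^- }(\alpha)$ are defined, then $g_s(\alpha)=g_{s^- }(\alpha)$.
   Context: $N_t:=\{\alpha\in2^\omega\mid t\subseteq\alpha\}$; $\psi:\omega\to2^{<\omega}$ enumerates finite binary sequences by increasing length and lexicographically within each length ($\psi(0)=\emptyset,\psi(1)=0,\psi(2)=1,\psi(3)=00,\dots$). $q_0:=0$, $q_{n+1}:=3\cdot2^{q_n}$, $t_n:=\psi(n)0^{2^{q_n}-|\psi(n)|}$, $S_n:=\{2^{q_n}j\mid j\ge1\}$. Define $\theta$ on $\{j\ge1\}$: if $L=1$, $\theta(j):=2j+1$; if $L\ge2$, with $P_L:=\{2^p3^l\mid p\in\omega,l<L-2\}$, $M_L:=\{2^{31}\cdot3\cdot k\mid k\ge1,k\notin P_L\}$: $\theta(j):=3j$ if $j\notin M_L\cup(M_L+1)$, $3j+3$ if $j\in M_L$, $3j-3$ if $j\in M_L+1$. $\theta_n(k):=k$ if $k\notin S_n$, $\theta_n(2^{q_n}j):=2^{q_n}\theta(j)$. $g_n=g_n^L:N_{t_n0}\to2^\omega$,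 $g_n(\alpha)(k)=1$ if $k=2^{q_n}$, $g_n(\alpha)(k)=\alpha(\theta_n(k))$ otherwise. $\mathbb{D}_n^1:=N_{t_n0}$; for $L\ge2$, $\mathbb{D}_n^L:=\{\alpha\in N_{t_n0}\mid\forall m\le n\ \alpha(2^{q_n}3^m)\ne\alpha(2^{q_n}3^{m+1})\}$. For nonempty $s\in\omega^{<\omega}$, $g_s:=g_{s(0)}\circ\cdots\circ g_{s(|s|-1)}$ (as a partial function), and $s^-:=(s(0),\dots,s(|s|-2))$. For partial functions $f_n$, $A^f:=\bigcup_n\text{Graph}(f_n)$. A strongly complex situation is $(X,(f_n))$ with $X$ a nonempty zero-dimensional perfect Polish space, each $f_n$ a partial continuous open map with clopen domain and range, $\Delta(X)\subseteq\overline{A^f}\setminus A^f$ (closure in $X^2$), and the restriction of any $f_n$ to any nonempty open subset of its domain not countable-to-one. -}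

module Defs where

open import Data.Nat using (ℕ; zero; suc; _+_; _*_; _∸_; _^_; _≤_; _<_; z≤n; s≤s; NonZero)
open import Data.Nat.Properties
open import Data.Nat.Divisibility using (_∣_; divides; _∣?_)
open import Data.Bool using (Bool; true; false)
open import Data.List using (List; []; _∷_; _++_; replicate; length; [_])
open import Data.Maybe using (Maybe; just; nothing; maybe)
open import Data.Fin using (Fin; toℕ; fromℕ<)
open import Data.Fin.Properties using (any?; toℕ<n; toℕ-fromℕ<)
open import Data.Sum using (inj₁; inj₂)
open import Data.Product using (Σ; ∃; _×_; _,_; proj₁; proj₂)
open import Data.Unit using (⊤)
open import Data.Empty using (⊥)
open import Relation.Nullary using (¬_; Dec; yes; no)
open import Relation.Binary.PropositionalEquality using (_≡_; refl; sym; trans; subst; subst₂; cong)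
open import Function using (_∘_; id)

Cantor : Set
Cantor = ℕ → Bool

-- equality of points of 2^ω (pointwise; no function extensionality)
_≈_ : Cantor → Cantor → Set
α ≈ β = ∀ k → α k ≡ β k

Agree : ℕ → Cantor → Cantor → Set
Agree k α β = ∀ i → i < k → α i ≡ β i

Prefix : List Bool → Cantor → Set
Prefix []      α = ⊤
Prefix (b ∷ t) α = (α 0 ≡ b) × Prefix t (α ∘ suc)

Open : (Cantor → Set) → Set
Open U = ∀ α → U α → Σ ℕ λ k → ∀ β → Agree k α β → U β

Closed : (Cantor → Set) → Set
Closed U = Open (λ α → ¬ U α)

Clopen : (Cantor → Set) → Set
Clopen U = Open U × Closed U

-- countable subset (possibly empty): covered by an ℕ-indexed enumeration
Countable : (Cantor → Set) → Set
Countable P = Σ (ℕ → Cantor) λ e → ∀ α → P α → Σ ℕ λ i → e i ≈ α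

Image : (Cantor → Cantor) → (Cantor → Set) → Cantor → Set
Image f U β = Σ Cantor λ α → U α × (f α ≈ β)

Perfect : Set
Perfect = ∀ α k → Σ Cantor λ β → Agree k α β × ¬ (β ≈ α)

-- strongly complex situation (2^ω, (f_n|D_n)_n): f n is defined (at least)
-- on D n, and the partial map considered is the restriction f n | D n
StronglyComplex : (ℕ → Cantor → Set) → (ℕ → Cantor → Cantor) → Set₁
StronglyComplex D f =
    Perfect
  × (∀ n → Clopen (D n))
  × (∀ n → Clopen (Image (f n) (D n)))
  × (∀ n α → D n α → ∀ k → Σ ℕ λ m → ∀ β → D n β → Agree m α β → Agree k (f n α) (f n β))
  × (∀ n (U : Cantor → Set) → Open U → (∀ α → U α → D n α) → Open (Image (f n) U))
  × (∀ α n → D n α → ¬ (f n α ≈ α))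
  -- Δ(X) ⊆ closure of A^f
  × (∀ α k → Σ ℕ λ n → Σ Cantor λ β → D n β × Agree k α β × Agree k α (f n β))
  × (∀ n (U : Cantor → Set) → Open U → (∀ α → U α → D n α) → Σ Cantor U
       → ¬ (∀ β → Countable (λ α → U α × (f n α ≈ β))))

-- ψ : ω → 2^{<ω}, by increasing length then lexicographically (0 < 1)

incr : List Bool → Maybe (List Bool)
incr [] = nothing
incr (b ∷ bs) with incr bs
... | just bs' = just (b ∷ bs')
incr (false ∷ bs) | nothing = just (true ∷ replicate (length bs) false)
incr (true ∷ bs)  | nothing = nothing

next : List Bool → List Bool
next s = maybe id (replicate (suc (length s)) false) (incr s)

ψ : ℕ → List Bool
ψ zero    = []
ψ (suc n) = next (ψ n)

q : ℕ → ℕ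
q zero    = 0
q (suc n) = 3 * 2 ^ q n

t0 : ℕ → List Bool
t0 n = ψ n ++ replicate (2 ^ q n ∸ length (ψ n)) false ++ [ false ]

P : ℕ → ℕ → Set
P L k = Σ ℕ λ p → Σ ℕ λ l → (l < L ∸ 2) × (2 ^ p * 3 ^ l ≡ k)

c31 : ℕ
c31 = 2 ^ 31 * 3

-- M_L = {2^31·3·k | k ≥ 1, k ∉ P_L} (written k·c with c = 2^31·3, to avoid unfolding the literal)
Mc : ℕ → ℕ → ℕ → Set
Mc c L j = Σ ℕ λ k → (1 ≤ k) × ¬ P L k × (j ≡ k * c)

M : ℕ → ℕ → Set
M L j = Mc c31 L j

M+1 : ℕ → ℕ → Set
M+1 L j = Σ ℕ λ i → M L i × (j ≡ i + 1)

private
  p<2^p : ∀ p → p < 2 ^ p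
  p<2^p zero = s≤s z≤n
  p<2^p (suc p) = ≤-trans (s≤s (p<2^p p)) (subst (suc (2 ^ p) ≤_) (+-comm (2 ^ p + 0) (2 ^ p)) (+-monoˡ-≤ (2 ^ p) (subst (1 ≤_) (sym (+-identityʳ (2 ^ p))) (m^n>0 2 p))))

  bound : ∀ p l k → 2 ^ p * 3 ^ l ≡ k → p < suc k
  bound p l k eq = ≤-trans (p<2^p p) (≤-trans (m≤m*n (2 ^ p) (3 ^ l) {{m^n≢0 3 l}})
                     (≤-trans (≤-reflexive eq) (n≤1+n k)))

P? : ∀ L k → Dec (P L k)
P? L k with any? {P = λ (p : Fin (suc k)) → Σ (Fin (L ∸ 2)) λ l → 2 ^ toℕ p * 3 ^ toℕ l ≡ k}
              (λ p → any? (λ l → 2 ^ toℕ p * 3 ^ toℕ l ≟ k))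
... | yes (p , l , eq) = yes (toℕ p , toℕ l , toℕ<n l , eq)
... | no ¬w = no λ { (p , l , l< , eq) → ¬w (fromℕ< (bound p l k eq) , fromℕ< l< ,
                        subst₂ (λ a b → 2 ^ a * 3 ^ b ≡ k)
                          (sym (toℕ-fromℕ< (bound p l k eq))) (sym (toℕ-fromℕ< l<)) eq) }

private
  ck≢0 : ∀ c .{{_ : NonZero c}} k → 1 ≤ k → ¬ (k * c ≡ 0)
  ck≢0 (suc c) (suc k) 1≤k ()

  Mc? : ∀ c .{{_ : NonZero c}} L j → Dec (Mc c L j)
  Mc? c L j with c ∣? j
  ... | no ¬d = no λ { (k , _ , _ , eq) → ¬d (divides k eq) }
  ... | yes (divides zero eq) = no λ { (k , 1≤k , _ , eq') → ck≢0 c k 1≤k (trans (sym eq') eq) }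
  ... | yes (divides (suc r) eq) with P? L (suc r)
  ...   | no ¬p = yes (suc r , s≤s z≤n , ¬p , eq)
  ...   | yes p = no λ { (k , _ , ¬p , eq') →
            ¬p (subst (P L) (*-cancelʳ-≡ (suc r) k c (trans (sym eq) eq')) p) }

M? : ∀ L j → Dec (M L j)
M? L j = Mc? c31 L j

M+1? : ∀ L j → Dec (M+1 L j)
M+1? L zero = no λ { (i , _ , eq) → 0≢1+n (trans eq (+-comm i 1)) }
M+1? L (suc j) with M? L j
... | yes m = yes (j , m , +-comm 1 j)
... | no ¬m = no λ { (i , m , eq) → ¬m (subst (M L) (suc-injective (trans (+-comm 1 i) (sym eq))) m) }

θ : ℕ → ℕ → ℕ
θ (suc zero) j = 2 * j + 1
θ L j with M? L j | M+1? L j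
... | yes _ | _     = 3 * j + 3
... | no _  | yes _ = 3 * j ∸ 3
... | no _  | no _  = 3 * j

θn : ℕ → ℕ → ℕ → ℕ
θn L n k with 2 ^ q n ∣? k
... | yes (divides (suc j) _) = 2 ^ q n * θ L (suc j)
... | yes (divides zero _)    = k
... | no _                    = k

-- g_n = g_n^L (total formula; its domain is N_{t_n 0}) and 𝔻_n^L

g : ℕ → ℕ → Cantor → Cantor
g L n α k with k ≟ 2 ^ q n
... | yes _ = true
... | no _  = α (θn L n k)

domg : ℕ → Cantor → Set
domg n α = Prefix (t0 n) α

𝔻 : ℕ → ℕ → Cantor → Set
𝔻 (suc (suc L)) n α =
  domg n α × (∀ m → m ≤ n → ¬ (α (2 ^ q n * 3 ^ m) ≡ α (2 ^ q n * 3 ^ suc m)))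
𝔻 _ n α = domg n α

gs : ℕ → List ℕ → Cantor → Cantor
gs L []      = id
gs L (n ∷ s) = g L n ∘ gs L s

Defined : ℕ → List ℕ → Cantor → Set
Defined L []      α = ⊤
Defined L (n ∷ s) α = Defined L s α × domg n (gs L s α)

-- (a) g_n copies α along the injective map θ_n, which never decreases its argument, so preimages
-- under g_n can be built coordinatewise; this gives openness, and flipping α at the infinitely many
-- coordinates that g_n never reads defeats any enumeration of a fibre. The diagonal lies in the
-- closure of the graphs because g_n is the identity below 2 ^ q_n and ψ is onto.
-- (b) Starting at 2 ^ q_m, every g_a with a < m multiplies the coordinate by 3, so for |s⁻| = r the
-- maps g_s and g_{s⁻} read α at 2 ^ q_m 3 ^ (r + 1) and 2 ^ q_m 3 ^ r, which differ on 𝔻_m.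
-- (c) Follow a coordinate back through g_{s⁻}. For L = 1 it ends outside S_{s(0)} or as an odd multiple
-- of 2 ^ q_{s(0)}. For L ≥ 2, once it is a multiple of 2 ^ q_m its 3-adic exponent grows by one at each
-- step, which P_L allows fewer than L - 1 times; after that the swap of θ at M_L produces an odd multiple
-- of a smaller power of 2. Either way it avoids S_m, where g_m is the identity.

module Submission where

open import Defs
open import Data.Nat using (ℕ; _≤_; _+_)
open import Data.List using (List; length; _∷ʳ_)
open import Data.List.Relation.Unary.Linked using (Linked)
open import Data.Product using (_×_)
open import Relation.Binary.PropositionalEquality using (_≡_)
open import Relation.Nullary using (¬_)
open import Data.Nat using (_<_)

open import Data.Nat
open import Data.Nat.Properties
open import Data.Nat.Divisibility
open import Data.Nat.Primality using (Prime; prime?; prime[2]; euclidsLemma)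
open import Data.Nat.Tactic.RingSolver using (solve-∀)
open import Data.Bool using (Bool; true; false; not)
open import Data.Unit using (⊤; tt)
open import Data.Maybe using (Maybe; just; nothing; maybe)
open import Data.Maybe.Properties using (just-injective)
open import Data.Product using (Σ; ∃; _,_; proj₁; proj₂)
open import Data.Sum using (_⊎_; inj₁; inj₂; map₁)
open import Data.List using ([]; _∷_; _++_; replicate; [_]; applyUpTo)
open import Data.List.Properties using (length-replicate; length-++; length-applyUpTo)
open import Data.List.Relation.Unary.All as All using (All; []; _∷_)
open import Data.List.Relation.Unary.Linked using ([]; [-]; _∷_)
open import Relation.Nullary using (Dec; yes; no; contradiction)
open import Relation.Nullary.Decidable using (from-yes; map′; _×-dec_; ¬?)
open import Data.Fin using (toℕ; fromℕ<)
open import Data.Fin.Properties using (any?; toℕ<n; toℕ-fromℕ<)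
open import Relation.Binary.PropositionalEquality using (_≢_; refl; sym; trans; cong; cong₂; subst; module ≡-Reasoning)
open import Relation.Binary.Definitions using (tri<; tri≈; tri>)
open import Function using (_∘_; id; case_of_)

3-prime : Prime 3
3-prime = from-yes (prime? 3)

2∤1 : 2 ∤ 1
2∤1 = >⇒∤ ≤-refl

3∤1 : 3 ∤ 1
3∤1 = >⇒∤ (s≤s (s≤s z≤n))

2∤3 : 2 ∤ 3
2∤3 (divides k 3≡k*2) = even≢odd k 1 (trans (*-comm 2 k) (sym 3≡k*2))

3∤2 : 3 ∤ 2
3∤2 = >⇒∤ ≤-refl

2∤2n+1 : ∀ n → 2 ∤ 2 * n + 1
2∤2n+1 n 2∣ = 2∤1 (∣m+n∣m⇒∣n 2∣ (m∣m*n n))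

3∤3n+1 : ∀ n → 3 ∤ 3 * n + 1
3∤3n+1 n 3∣ = 3∤1 (∣m+n∣m⇒∣n 3∣ (m∣m*n n))

3∣2*m⇒3∣m : ∀ {m} → 3 ∣ 2 * m → 3 ∣ m
3∣2*m⇒3∣m {m} 3∣2m with euclidsLemma 2 m 3-prime 3∣2m
... | inj₁ 3∣2 = contradiction 3∣2 3∤2
... | inj₂ 3∣m = 3∣m

2∣3*m⇒2∣m : ∀ {m} → 2 ∣ 3 * m → 2 ∣ m
2∣3*m⇒2∣m {m} 2∣3m with euclidsLemma 3 m prime[2] 2∣3m
... | inj₁ 2∣3 = contradiction 2∣3 2∤3
... | inj₂ 2∣m = 2∣m

3∣2^n*m⇒3∣m : ∀ n m → 3 ∣ 2 ^ n * m → 3 ∣ m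
3∣2^n*m⇒3∣m zero    m 3∣ = subst (3 ∣_) (+-identityʳ m) 3∣
3∣2^n*m⇒3∣m (suc n) m 3∣ = 3∣2^n*m⇒3∣m n m (3∣2*m⇒3∣m (subst (3 ∣_) (*-assoc 2 (2 ^ n) m) 3∣))

2∣3^n*m⇒2∣m : ∀ n m → 2 ∣ 3 ^ n * m → 2 ∣ m
2∣3^n*m⇒2∣m zero    m 2∣ = subst (2 ∣_) (+-identityʳ m) 2∣
2∣3^n*m⇒2∣m (suc n) m 2∣ = 2∣3^n*m⇒2∣m n m (2∣3*m⇒2∣m (subst (2 ∣_) (*-assoc 3 (3 ^ n) m) 2∣))

3∤2^n : ∀ n → 3 ∤ 2 ^ n
3∤2^n n 3∣ = 3∤1 (3∣2^n*m⇒3∣m n 1 (subst (3 ∣_) (sym (*-identityʳ (2 ^ n))) 3∣))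

2∤3^n : ∀ n → 2 ∤ 3 ^ n
2∤3^n n 2∣ = 2∤1 (2∣3^n*m⇒2∣m n 1 (subst (2 ∣_) (sym (*-identityʳ (3 ^ n))) 2∣))

2^n*-cancelˡ-≡ : ∀ n {x y} → 2 ^ n * x ≡ 2 ^ n * y → x ≡ y
2^n*-cancelˡ-≡ n {x} {y} = *-cancelˡ-≡ x y (2 ^ n) {{m^n≢0 2 n}}

3*-cancelˡ-≡ : ∀ {x y} → 3 * x ≡ 3 * y → x ≡ y
3*-cancelˡ-≡ {x} {y} = *-cancelˡ-≡ x y 3

n<2^n : ∀ n → n < 2 ^ n
n<2^n zero    = z<s
n<2^n (suc n) = ≤-trans (+-mono-≤ (m^n>0 2 n) (n<2^n n)) (+-monoʳ-≤ (2 ^ n) (m≤m+n (2 ^ n) 0))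

1≤2^a*3^b : ∀ a b → 1 ≤ 2 ^ a * 3 ^ b
1≤2^a*3^b a b = *-mono-≤ (m^n>0 2 a) (m^n>0 3 b)

3^-injective : ∀ {a b} → 3 ^ a ≡ 3 ^ b → a ≡ b
3^-injective {a} {b} eq with <-cmp a b
... | tri< a<b _ _ = contradiction eq (<⇒≢ (^-monoʳ-< 3 (s≤s (s≤s z≤n)) a<b))
... | tri≈ _ a≡b _ = a≡b
... | tri> _ _ b<a = contradiction (sym eq) (<⇒≢ (^-monoʳ-< 3 (s≤s (s≤s z≤n)) b<a))

2*m≡2^p*3^l⇒p≡1+p′ : ∀ m p l → 2 * m ≡ 2 ^ p * 3 ^ l → ∃ λ p′ → p ≡ suc p′ × m ≡ 2 ^ p′ * 3 ^ l
2*m≡2^p*3^l⇒p≡1+p′ m zero    l eq =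
  contradiction (divides m (trans (sym (trans eq (+-identityʳ (3 ^ l)))) (*-comm 2 m))) (2∤3^n l)
2*m≡2^p*3^l⇒p≡1+p′ m (suc p) l eq = p , refl , *-cancelˡ-≡ m _ 2 (trans eq (*-assoc 2 (2 ^ p) (3 ^ l)))

3*m≡2^p*3^l⇒l≡1+l′ : ∀ m p l → 3 * m ≡ 2 ^ p * 3 ^ l → ∃ λ l′ → l ≡ suc l′ × m ≡ 2 ^ p * 3 ^ l′
3*m≡2^p*3^l⇒l≡1+l′ m p zero    eq =
  contradiction (divides m (trans (sym (trans eq (*-identityʳ (2 ^ p)))) (*-comm 3 m))) (3∤2^n p)
3*m≡2^p*3^l⇒l≡1+l′ m p (suc l) eq = l , refl , *-cancelˡ-≡ m _ 3 (trans eq (swap-3 (2 ^ p) (3 ^ l)))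
  where
  swap-3 : ∀ a b → a * (3 * b) ≡ 3 * (a * b)
  swap-3 = solve-∀

2^n*m≡2^p*3^l⇒p≡n+p′ : ∀ n m p l → 2 ^ n * m ≡ 2 ^ p * 3 ^ l → ∃ λ p′ → p ≡ n + p′ × m ≡ 2 ^ p′ * 3 ^ l
2^n*m≡2^p*3^l⇒p≡n+p′ zero    m p l eq = p , refl , trans (sym (+-identityʳ m)) eq
2^n*m≡2^p*3^l⇒p≡n+p′ (suc n) m p l eq
  with 2*m≡2^p*3^l⇒p≡1+p′ (2 ^ n * m) p l (trans (sym (*-assoc 2 (2 ^ n) m)) eq)
... | p₁ , refl , eq₁ with 2^n*m≡2^p*3^l⇒p≡n+p′ n m p₁ l eq₁
...   | p′ , refl , eq′ = p′ , refl , eq′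

3^n*m≡2^p*3^l⇒n≤l : ∀ n m p l → 3 ^ n * m ≡ 2 ^ p * 3 ^ l → n ≤ l
3^n*m≡2^p*3^l⇒n≤l zero    m p l eq = z≤n
3^n*m≡2^p*3^l⇒n≤l (suc n) m p l eq
  with 3*m≡2^p*3^l⇒l≡1+l′ (3 ^ n * m) p l (trans (sym (*-assoc 3 (3 ^ n) m)) eq)
... | l′ , refl , eq′ = s≤s (3^n*m≡2^p*3^l⇒n≤l n m p l′ eq′)

M⇒3∣ : ∀ {L j} → M L j → 3 ∣ j
M⇒3∣ (k , _ , _ , refl) = ∣n⇒∣m*n k (n∣m*n (2 ^ 31))

M⇒2∣ : ∀ {L j} → M L j → 2 ∣ j
M⇒2∣ (k , _ , _ , refl) = ∣n⇒∣m*n k (∣m⇒∣m*n {m = 2 ^ 31} 3 (m∣m*n (2 ^ 30)))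

M+1⇒3∤ : ∀ {L j} → M+1 L j → 3 ∤ j
M+1⇒3∤ {L} (i , i∈M , refl) 3∣i+1 = 3∤1 (∣m+n∣m⇒∣n 3∣i+1 (M⇒3∣ {L} i∈M))

M+1⇒2∤ : ∀ {L j} → M+1 L j → 2 ∤ j
M+1⇒2∤ {L} (i , i∈M , refl) 2∣i+1 = 2∤1 (∣m+n∣m⇒∣n 2∣i+1 (M⇒2∣ {L} i∈M))

M⇒suc∉M : ∀ {L j} → M L j → ¬ M L (j + 1)
M⇒suc∉M {L} {j} j∈M j+1∈M = M+1⇒3∤ {L} (j , j∈M , refl) (M⇒3∣ {L} j+1∈M)

M⇒≥1 : ∀ {L j} → M L j → 1 ≤ j
M⇒≥1 (k , 1≤k , _ , refl) = ≤-trans 1≤k (m≤m*n k c31)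

data ΘView (L j : ℕ) : Set where
  in-M   : M L j → θ L j ≡ 3 * (j + 1) → ΘView L j
  in-M+1 : ∀ i → M L i → j ≡ i + 1 → θ L j ≡ 3 * i → ΘView L j
  other  : ¬ M L j → ¬ M+1 L j → θ L j ≡ 3 * j → ΘView L j

private
  θ-cases : ∀ L j → (M (2 + L) j × θ (2 + L) j ≡ 3 * j + 3)
                  ⊎ (M+1 (2 + L) j × θ (2 + L) j ≡ 3 * j ∸ 3)
                  ⊎ (¬ M (2 + L) j × ¬ M+1 (2 + L) j × θ (2 + L) j ≡ 3 * j)
  θ-cases L j with M? (suc (suc L)) j | M+1? (suc (suc L)) j
  ... | yes j∈M | _         = inj₁ (j∈M , refl)
  ... | no _    | yes j∈M+1 = inj₂ (inj₁ (j∈M+1 , refl))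
  ... | no j∉M  | no j∉M+1  = inj₂ (inj₂ (j∉M , j∉M+1 , refl))

θ-view : ∀ L j → ΘView (2 + L) j
θ-view L j with θ-cases L j
... | inj₁ (j∈M , eq) = in-M j∈M (trans eq (sym (*-distribˡ-+ 3 j 1)))
... | inj₂ (inj₁ ((i , i∈M , refl) , eq)) =
  in-M+1 i i∈M refl (trans eq (trans (cong (_∸ 3) (*-distribˡ-+ 3 i 1)) (m+n∸n≡m (3 * i) 3)))
... | inj₂ (inj₂ (j∉M , j∉M+1 , eq)) = other j∉M j∉M+1 eq

3∣θ : ∀ L j → 3 ∣ θ (2 + L) j
3∣θ L j with θ-view L j
... | in-M _ eq         = subst (3 ∣_) (sym eq) (m∣m*n (j + 1))
... | in-M+1 i _ _ eq   = subst (3 ∣_) (sym eq) (m∣m*n i)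
... | other _ _ eq      = subst (3 ∣_) (sym eq) (m∣m*n j)

θ-≥ : ∀ L j → 1 ≤ L → j ≤ θ L j
θ-≥ (suc zero)    j _ = ≤-trans (m≤m+n j (j + 0)) (m≤m+n (2 * j) 1)
θ-≥ (suc (suc L)) j _ with θ-view L j
... | in-M _ eq            = subst (j ≤_) (sym eq) (≤-trans (m≤m+n j 1) (m≤n*m (j + 1) 3))
... | in-M+1 i i∈M refl eq = subst (i + 1 ≤_) (sym eq) (+-monoʳ-≤ i (≤-trans (M⇒≥1 {2 + L} i∈M) (m≤m+n i (i + 0))))
... | other _ _ eq         = subst (j ≤_) (sym eq) (m≤n*m j 3)

θ-injective : ∀ L {j j′} → 1 ≤ L → θ L j ≡ θ L j′ → j ≡ j′
θ-injective (suc zero)    {j} {j′} _ eq = *-cancelˡ-≡ j j′ 2 (+-cancelʳ-≡ 1 (2 * j) (2 * j′) eq)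
θ-injective (suc (suc L)) {j} {j′} _ eq = collide (θ-view L j) (θ-view L j′) eq
  where
  -- θ j = 3 r for r ∈ {j - 1, j, j + 1}; two arguments colliding on r must coincide.
  collide : ∀ {j j′} → ΘView (2 + L) j → ΘView (2 + L) j′ → θ (2 + L) j ≡ θ (2 + L) j′ → j ≡ j′
  collide {j} {j′} (in-M _ e) (in-M _ e′) eq =
    +-cancelʳ-≡ 1 j j′ (3*-cancelˡ-≡ (trans (sym e) (trans eq e′)))
  collide {j} (in-M j∈M e) (in-M+1 i i∈M _ e′) eq with 3*-cancelˡ-≡ {j + 1} {i} (trans (sym e) (trans eq e′))
  ... | refl = contradiction i∈M (M⇒suc∉M {2 + L} j∈M)
  collide {j} {j′} (in-M j∈M e) (other _ j′∉M+1 e′) eq with 3*-cancelˡ-≡ {j + 1} {j′} (trans (sym e) (trans eq e′))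
  ... | refl = contradiction (j , j∈M , refl) j′∉M+1
  collide (in-M+1 i _ j≡ e) (in-M+1 i′ _ j′≡ e′) eq =
    trans j≡ (trans (cong (_+ 1) (3*-cancelˡ-≡ (trans (sym e) (trans eq e′)))) (sym j′≡))
  collide {j′ = j′} (in-M+1 i i∈M _ e) (other j′∉M _ e′) eq with 3*-cancelˡ-≡ {i} {j′} (trans (sym e) (trans eq e′))
  ... | refl = contradiction i∈M j′∉M
  collide (other _ _ e) (other _ _ e′) eq = 3*-cancelˡ-≡ (trans (sym e) (trans eq e′))
  collide v@(in-M+1 _ _ _ _) v′@(in-M _ _)         eq = sym (collide v′ v (sym eq))
  collide v@(other _ _ _)    v′@(in-M _ _)         eq = sym (collide v′ v (sym eq))
  collide v@(other _ _ _)    v′@(in-M+1 _ _ _ _)   eq = sym (collide v′ v (sym eq))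

q-<-suc : ∀ n → q n < q (suc n)
q-<-suc n = ≤-trans (n<2^n (q n)) (m≤n*m (2 ^ q n) 3)

q-monoʳ-< : ∀ {a b} → a < b → q a < q b
q-monoʳ-< {a} {suc b} (s≤s a≤b) with m≤n⇒m<n∨m≡n a≤b
... | inj₁ a<b  = <-trans (q-monoʳ-< a<b) (q-<-suc b)
... | inj₂ refl = q-<-suc a

q-monoʳ-≤ : ∀ {a b} → a ≤ b → q a ≤ q b
q-monoʳ-≤ a≤b with m≤n⇒m<n∨m≡n a≤b
... | inj₁ a<b  = <⇒≤ (q-monoʳ-< a<b)
... | inj₂ refl = ≤-refl

n≤q : ∀ n → n ≤ q n
n≤q zero    = z≤n
n≤q (suc n) = ≤-trans (s≤s (n≤q n)) (q-<-suc n)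

S : ℕ → ℕ → Set
S n x = ∃ λ j → x ≡ 2 ^ q n * suc j

2^q*[1+j]≢0 : ∀ n j → 2 ^ q n * suc j ≢ 0
2^q*[1+j]≢0 n j = ≢-nonZero⁻¹ (2 ^ q n * suc j) {{m*n≢0 (2 ^ q n) (suc j) {{m^n≢0 2 (q n)}}}}

S? : ∀ n x → Dec (S n x)
S? n x with 2 ^ q n ∣? x
... | yes (divides (suc j) eq) = yes (j , trans eq (*-comm (suc j) (2 ^ q n)))
... | yes (divides zero eq)    = no λ (j , eq′) → 2^q*[1+j]≢0 n j (trans (sym eq′) eq)
... | no ∤x                    = no λ (j , eq′) → ∤x (divides (suc j) (trans eq′ (*-comm (2 ^ q n) (suc j))))

θn-S : ∀ L n {x} j → x ≡ 2 ^ q n * suc j → θn L n x ≡ 2 ^ q n * θ L (suc j)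
θn-S L n {x} j eq with 2 ^ q n ∣? x
... | yes (divides (suc j′) eq′) = cong (λ t → 2 ^ q n * θ L t)
        (*-cancelʳ-≡ (suc j′) (suc j) (2 ^ q n) {{m^n≢0 2 (q n)}} (trans (sym eq′) (trans eq (*-comm (2 ^ q n) (suc j)))))
... | yes (divides zero eq′)     = contradiction (trans (sym eq) eq′) (2^q*[1+j]≢0 n j)
... | no ∤x                      = contradiction (divides (suc j) (trans eq (*-comm (2 ^ q n) (suc j)))) ∤x

θn-2^q* : ∀ L n {x y} → 1 ≤ y → x ≡ 2 ^ q n * y → θn L n x ≡ 2 ^ q n * θ L y
θn-2^q* L n {y = suc j} _ = θn-S L n j

θn-¬S : ∀ L n {x} → ¬ S n x → θn L n x ≡ x
θn-¬S L n {x} x∉S with 2 ^ q n ∣? x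
... | yes (divides (suc j) eq) = contradiction (j , trans eq (*-comm (suc j) (2 ^ q n))) x∉S
... | yes (divides zero _)     = refl
... | no _                     = refl

θn-≥ : ∀ L n x → 1 ≤ L → x ≤ θn L n x
θn-≥ L n x 1≤L with S? n x
... | yes (j , refl) = subst (2 ^ q n * suc j ≤_) (sym (θn-S L n j refl)) (*-monoʳ-≤ (2 ^ q n) (θ-≥ L (suc j) 1≤L))
... | no x∉S         = ≤-reflexive (sym (θn-¬S L n x∉S))

θn-pres-S : ∀ L n {x} → 1 ≤ L → S n x → S n (θn L n x)
θn-pres-S L n 1≤L (j , eq) with θ L (suc j) | θ-≥ L (suc j) 1≤L | θn-S L n j eq
... | suc t | _ | eq′ = t , eq′

θn-injective : ∀ L n {x y} → 1 ≤ L → θn L n x ≡ θn L n y → x ≡ y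
θn-injective L n {x} {y} 1≤L eq with S? n x | S? n y
... | yes (j , refl) | yes (j′ , refl) = cong (λ t → 2 ^ q n * t) (θ-injective L 1≤L
        (2^n*-cancelˡ-≡ (q n) (trans (sym (θn-S L n j refl)) (trans eq (θn-S L n j′ refl)))))
... | yes x∈S | no y∉S = contradiction (subst (S n) (trans eq (θn-¬S L n y∉S)) (θn-pres-S L n 1≤L x∈S)) y∉S
... | no x∉S | yes y∈S = contradiction (subst (S n) (trans (sym eq) (θn-¬S L n x∉S)) (θn-pres-S L n 1≤L y∈S)) x∉S
... | no x∉S | no y∉S  = trans (sym (θn-¬S L n x∉S)) (trans eq (θn-¬S L n y∉S))

nth : List Bool → ℕ → Bool
nth []      _       = false
nth (b ∷ t) zero    = b
nth (b ∷ t) (suc i) = nth t i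

Prefix⇒nth : ∀ t α → Prefix t α → ∀ i → i < length t → α i ≡ nth t i
Prefix⇒nth (b ∷ t) α (α0≡b , _) zero    _         = α0≡b
Prefix⇒nth (b ∷ t) α (_ , pre)  (suc i) (s≤s i<n) = Prefix⇒nth t (α ∘ suc) pre i i<n

nth⇒Prefix : ∀ t α → (∀ i → i < length t → α i ≡ nth t i) → Prefix t α
nth⇒Prefix []      α _ = tt
nth⇒Prefix (b ∷ t) α h = h zero z<s , nth⇒Prefix t (α ∘ suc) (λ i i<n → h (suc i) (s≤s i<n))

nth-++ˡ : ∀ xs ys i → i < length xs → nth (xs ++ ys) i ≡ nth xs i
nth-++ˡ (x ∷ xs) ys zero    _         = refl
nth-++ˡ (x ∷ xs) ys (suc i) (s≤s i<n) = nth-++ˡ xs ys i i<n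

nth-++ʳ : ∀ xs ys i → nth (xs ++ ys) (length xs + i) ≡ nth ys i
nth-++ʳ []       ys i = refl
nth-++ʳ (x ∷ xs) ys i = nth-++ʳ xs ys i

nth-falses : ∀ r i → nth (replicate r false ++ [ false ]) i ≡ false
nth-falses zero    zero    = refl
nth-falses zero    (suc i) = refl
nth-falses (suc r) zero    = refl
nth-falses (suc r) (suc i) = nth-falses r i

incr-length : ∀ s {s′} → incr s ≡ just s′ → length s′ ≡ length s
incr-length (b ∷ bs) eq with incr bs in eq′
incr-length (b ∷ bs)     refl | just bs′ = cong suc (incr-length bs eq′)
incr-length (false ∷ bs) refl | nothing  = cong suc (length-replicate (length bs))

length-next : ∀ s → length (next s) ≤ suc (length s)
length-next s with incr s in eq
... | just s′ = ≤-trans (≤-reflexive (incr-length s eq)) (n≤1+n _)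
... | nothing = ≤-reflexive (length-replicate (suc (length s)))

length-ψ : ∀ n → length (ψ n) ≤ n
length-ψ zero    = z≤n
length-ψ (suc n) = ≤-trans (length-next (ψ n)) (s≤s (length-ψ n))

length-ψ≤2^q : ∀ n → length (ψ n) ≤ 2 ^ q n
length-ψ≤2^q n = ≤-trans (length-ψ n) (≤-trans (n≤q n) (<⇒≤ (n<2^n (q n))))

length-t0 : ∀ n → length (t0 n) ≡ suc (2 ^ q n)
length-t0 n = begin
  length (ψ n ++ replicate r false ++ [ false ])  ≡⟨ length-++ (ψ n) ⟩
  length (ψ n) + length (replicate r false ++ [ false ])
    ≡⟨ cong (length (ψ n) +_) (trans (length-++ (replicate r false)) (cong (_+ 1) (length-replicate r))) ⟩
  length (ψ n) + (r + 1)                          ≡⟨ sym (+-assoc (length (ψ n)) r 1) ⟩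
  length (ψ n) + r + 1                            ≡⟨ cong (_+ 1) (m+[n∸m]≡n (length-ψ≤2^q n)) ⟩
  2 ^ q n + 1                                     ≡⟨ +-comm (2 ^ q n) 1 ⟩
  suc (2 ^ q n)                                   ∎
  where
  open ≡-Reasoning
  r = 2 ^ q n ∸ length (ψ n)

nth-t0-ψ : ∀ n i → i < length (ψ n) → nth (t0 n) i ≡ nth (ψ n) i
nth-t0-ψ n i = nth-++ˡ (ψ n) _ i

nth-t0-padding : ∀ n i → length (ψ n) ≤ i → nth (t0 n) i ≡ false
nth-t0-padding n i ψ≤i = begin
  nth (t0 n) i                       ≡⟨ cong (nth (t0 n)) (sym (m+[n∸m]≡n ψ≤i)) ⟩
  nth (t0 n) (length (ψ n) + (i ∸ length (ψ n)))
    ≡⟨ nth-++ʳ (ψ n) _ (i ∸ length (ψ n)) ⟩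
  nth (replicate r false ++ [ false ]) (i ∸ length (ψ n))
    ≡⟨ nth-falses r (i ∸ length (ψ n)) ⟩
  false                              ∎
  where
  open ≡-Reasoning
  r = 2 ^ q n ∸ length (ψ n)

domg⇒nth : ∀ n α → domg n α → ∀ i → i ≤ 2 ^ q n → α i ≡ nth (t0 n) i
domg⇒nth n α d i i≤ = Prefix⇒nth (t0 n) α d i (subst (i <_) (sym (length-t0 n)) (s≤s i≤))

nth⇒domg : ∀ n α → (∀ i → i ≤ 2 ^ q n → α i ≡ nth (t0 n) i) → domg n α
nth⇒domg n α h = nth⇒Prefix (t0 n) α (λ i i< → h i (≤-pred (subst (i <_) (length-t0 n) i<)))

domg-2^q : ∀ n α → domg n α → α (2 ^ q n) ≡ false
domg-2^q n α d = trans (domg⇒nth n α d (2 ^ q n) ≤-refl) (nth-t0-padding n (2 ^ q n) (length-ψ≤2^q n))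

domg-resp-Agree : ∀ n α β → domg n α → Agree (suc (2 ^ q n)) α β → domg n β
domg-resp-Agree n α β d α≈β =
  nth⇒domg n β (λ i i≤ → trans (sym (α≈β i (s≤s i≤))) (domg⇒nth n α d i i≤))

data Reachable : List Bool → List Bool → Set where
  here  : ∀ {u} → Reachable u u
  there : ∀ {u u₁ u′} → incr u ≡ just u₁ → Reachable u₁ u′ → Reachable u u′

Reachable-trans : ∀ {a b c} → Reachable a b → Reachable b c → Reachable a c
Reachable-trans here          r′ = r′
Reachable-trans (there eq r) r′ = there eq (Reachable-trans r r′)

incr-∷ : ∀ b {u u₁} → incr u ≡ just u₁ → incr (b ∷ u) ≡ just (b ∷ u₁)
incr-∷ b {u} eq with incr u
incr-∷ b refl | just _ = refl

Reachable-∷ : ∀ b {u u′} → Reachable u u′ → Reachable (b ∷ u) (b ∷ u′)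
Reachable-∷ b here         = here
Reachable-∷ b (there eq r) = there (incr-∷ b eq) (Reachable-∷ b r)

incr-trues : ∀ l → incr (replicate l true) ≡ nothing
incr-trues zero    = refl
incr-trues (suc l) with incr (replicate l true) | incr-trues l
... | nothing | _ = refl

incr-false∷trues : ∀ l → incr (false ∷ replicate l true) ≡ just (true ∷ replicate l false)
incr-false∷trues l with incr (replicate l true) | incr-trues l
... | nothing | _ = cong (λ k → just (true ∷ replicate k false)) (length-replicate l)

falses↝trues : ∀ l → Reachable (replicate l false) (replicate l true)
falses↝trues zero    = here
falses↝trues (suc l) = Reachable-trans (Reachable-∷ false (falses↝trues l))
  (there (incr-false∷trues l) (Reachable-∷ true (falses↝trues l)))

falses↝ : ∀ t → Reachable (replicate (length t) false) t
falses↝ []          = here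
falses↝ (false ∷ t) = Reachable-∷ false (falses↝ t)
falses↝ (true ∷ t)  = Reachable-trans (Reachable-∷ false (falses↝trues (length t)))
  (there (incr-false∷trues (length t)) (Reachable-∷ true (falses↝ t)))

ψ-Reachable : ∀ n {u′} → Reachable (ψ n) u′ → ∃ λ m → ψ m ≡ u′
ψ-Reachable n = go n refl
  where
  go : ∀ n {u u′} → ψ n ≡ u → Reachable u u′ → ∃ λ m → ψ m ≡ u′
  go n ψn≡u here = n , ψn≡u
  go n ψn≡u (there eq r) = go (suc n) (trans (cong next ψn≡u) (cong (maybe id _) eq)) r

ψ-falses : ∀ l → ∃ λ n → ψ n ≡ replicate l false
ψ-falses zero = zero , refl
ψ-falses (suc l) with ψ-falses l
... | n , eq with ψ-Reachable n (subst (λ u → Reachable u (replicate l true)) (sym eq) (falses↝trues l))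
...   | m , eq′ = suc m , (begin
  next (ψ m)                  ≡⟨ cong next eq′ ⟩
  next (replicate l true)     ≡⟨ cong (maybe id (replicate (suc (length (replicate l true))) false)) (incr-trues l) ⟩
  replicate (suc (length (replicate l true))) false ≡⟨ cong (λ k → replicate (suc k) false) (length-replicate l) ⟩
  replicate (suc l) false     ∎)
  where open ≡-Reasoning

ψ-surjective : ∀ t → ∃ λ n → ψ n ≡ t
ψ-surjective t with ψ-falses (length t)
... | n , eq = ψ-Reachable n (subst (λ u → Reachable u t) (sym eq) (falses↝ t))

g-2^q : ∀ L n α {k} → k ≡ 2 ^ q n → g L n α k ≡ true
g-2^q L n α {k} eq with k ≟ 2 ^ q n
... | yes _  = refl
... | no k≢  = contradiction eq k≢

g-≢2^q : ∀ L n α {k} → k ≢ 2 ^ q n → g L n α k ≡ α (θn L n k)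
g-≢2^q L n α {k} k≢ with k ≟ 2 ^ q n
... | yes eq = contradiction eq k≢
... | no _   = refl

g-cong : ∀ L n α β k → (k ≢ 2 ^ q n → α (θn L n k) ≡ β (θn L n k)) → g L n α k ≡ g L n β k
g-cong L n α β k same with k ≟ 2 ^ q n
... | yes _  = refl
... | no k≢  = same k≢

g-no-fixpoint : ∀ L n α → domg n α → ¬ (g L n α ≈ α)
g-no-fixpoint L n α d gα≈α with trans (sym (g-2^q L n α refl)) (trans (gα≈α (2 ^ q n)) (domg-2^q n α d))
... | ()

𝔻⇒domg : ∀ L n α → 𝔻 L n α → domg n α
𝔻⇒domg zero          n α d       = d
𝔻⇒domg (suc zero)    n α d       = d
𝔻⇒domg (suc (suc L)) n α (d , _) = d

𝔻-radius : ℕ → ℕ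
𝔻-radius n = suc (2 ^ q n * 3 ^ suc n)

2^q<𝔻-radius : ∀ n → 2 ^ q n < 𝔻-radius n
2^q<𝔻-radius n = s≤s (m≤m*n (2 ^ q n) (3 ^ suc n) {{m^n≢0 3 (suc n)}})

Agree-≤ : ∀ {k k′ α β} → k ≤ k′ → Agree k′ α β → Agree k α β
Agree-≤ k≤k′ α≈β i i<k = α≈β i (≤-trans i<k k≤k′)

Agree-sym : ∀ {k α β} → Agree k α β → Agree k β α
Agree-sym α≈β i i<k = sym (α≈β i i<k)

𝔻-resp-Agree : ∀ L n α β → Agree (𝔻-radius n) α β → 𝔻 L n α → 𝔻 L n β
𝔻-resp-Agree zero          n α β α≈β d = domg-resp-Agree n α β d (Agree-≤ (2^q<𝔻-radius n) α≈β)
𝔻-resp-Agree (suc zero)    n α β α≈β d = domg-resp-Agree n α β d (Agree-≤ (2^q<𝔻-radius n) α≈β)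
𝔻-resp-Agree (suc (suc L)) n α β α≈β (d , alt) =
  domg-resp-Agree n α β d (Agree-≤ (2^q<𝔻-radius n) α≈β) ,
  λ m m≤n eq → alt m m≤n (trans (α≈β _ (below (m≤n⇒m≤1+n m≤n))) (trans eq (sym (α≈β _ (below (s≤s m≤n))))))
  where
  below : ∀ {m} → m ≤ suc n → 2 ^ q n * 3 ^ m < 𝔻-radius n
  below m≤ = s≤s (*-monoʳ-≤ (2 ^ q n) (^-monoʳ-≤ 3 m≤))

𝔻-clopen : ∀ L n → Clopen (𝔻 L n)
𝔻-clopen L n = (λ α d → 𝔻-radius n , λ β α≈β → 𝔻-resp-Agree L n α β α≈β d)
             , (λ α ¬d → 𝔻-radius n , λ β α≈β d → ¬d (𝔻-resp-Agree L n β α (Agree-sym α≈β) d))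

∃<? : {P : ℕ → Set} → (∀ k → Dec (P k)) → ∀ n → Dec (∃ λ k → k < n × P k)
∃<? {P} P? n = map′ (λ (i , p) → toℕ i , toℕ<n i , p)
                    (λ (k , k<n , p) → fromℕ< k<n , subst P (sym (toℕ-fromℕ< k<n)) p)
                    (any? (P? ∘ toℕ))

module Patch {D : ℕ → Set} (D? : ∀ k → Dec (D k)) (f : ℕ → ℕ)
             (f-≥ : ∀ {k} → D k → k ≤ f k) (f-injective : ∀ {k k′} → f k ≡ f k′ → k ≡ k′)
             (val dflt : ℕ → Bool) where

  private
    hit? : ∀ x → Dec (∃ λ k → k < suc x × (D k × f k ≡ x))
    hit? x = ∃<? (λ k → D? k ×-dec f k ≟ x) (suc x)

  patch : Cantor
  patch x with hit? x
  ... | yes (k , _ , _) = val k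
  ... | no _            = dflt x

  patch-hit : ∀ {k} → D k → patch (f k) ≡ val k
  patch-hit {k} k∈D with hit? (f k)
  ... | yes (k′ , _ , _ , eq) = cong val (f-injective eq)
  ... | no ¬hit               = contradiction (k , s≤s (f-≥ k∈D) , k∈D , refl) ¬hit

  patch-miss : ∀ {x} → (∀ k → D k → f k ≢ x) → patch x ≡ dflt x
  patch-miss {x} miss with hit? x
  ... | yes (k , _ , k∈D , eq) = contradiction eq (miss k k∈D)
  ... | no _                   = refl

  patch-view : ∀ x → (∃ λ k → D k × f k ≡ x × patch x ≡ val k) ⊎ patch x ≡ dflt x
  patch-view x with hit? x
  ... | yes (k , _ , k∈D , eq) = inj₁ (k , k∈D , eq , refl)
  ... | no _                   = inj₂ refl

-- (a) The strongly complex situation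

b≢not-b : ∀ b → b ≢ not b
b≢not-b true  ()
b≢not-b false ()

perfect : Perfect
perfect α k = β , α≈β , β≉α
  where
  β : Cantor
  β i with i ≟ k
  ... | yes _ = not (α k)
  ... | no _  = α i
  α≈β : Agree k α β
  α≈β i i<k with i ≟ k
  ... | yes refl = contradiction i<k (<-irrefl refl)
  ... | no _     = refl
  β≉α : ¬ (β ≈ α)
  β≉α β≈α with k ≟ k | β≈α k
  ... | yes _  | eq = b≢not-b (α k) (sym eq)
  ... | no k≢k | _  = k≢k refl

g-modulus : ℕ → ℕ → ℕ → ℕ
g-modulus L n zero    = zero
g-modulus L n (suc k) = g-modulus L n k + suc (θn L n k)

θn<g-modulus : ∀ L n {k i} → i < k → θn L n i < g-modulus L n k
θn<g-modulus L n {suc k} {i} i<1+k with m<1+n⇒m<n∨m≡n i<1+k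
... | inj₁ i<k  = ≤-trans (θn<g-modulus L n i<k) (m≤m+n _ _)
... | inj₂ refl = m≤n+m (suc (θn L n i)) (g-modulus L n i)

g-continuous : ∀ L n α β k → Agree (g-modulus L n k) α β → Agree k (g L n α) (g L n β)
g-continuous L n α β k α≈β i i<k = g-cong L n α β i λ _ → α≈β _ (θn<g-modulus L n i<k)

-- Redefine α at the positions θ_n k read by g, which is possible as θ_n is injective.
g-lift : ∀ L n → 1 ≤ L → ∀ α β K → 2 ^ q n < K → Agree K (g L n α) β
       → ∃ λ α′ → Agree K α α′ × g L n α′ ≈ β
g-lift L n 1≤L α β K 2^q<K gα≈β = patch , α≈patch , g-patch≈β
  where
  open Patch (λ k → ¬? (k ≟ 2 ^ q n)) (θn L n) (λ {k} _ → θn-≥ L n k 1≤L) (θn-injective L n 1≤L) β α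
  α≈patch : Agree K α patch
  α≈patch x x<K with patch-view x
  ... | inj₁ (k , k≢ , refl , eq) = begin
    α (θn L n k)   ≡⟨ sym (g-≢2^q L n α k≢) ⟩
    g L n α k      ≡⟨ gα≈β k (≤-<-trans (θn-≥ L n k 1≤L) x<K) ⟩
    β k            ≡⟨ sym eq ⟩
    patch (θn L n k) ∎
    where open ≡-Reasoning
  ... | inj₂ eq = sym eq
  g-patch≈β : g L n patch ≈ β
  g-patch≈β i = case i ≟ 2 ^ q n of λ where
    (yes refl) → trans (g-2^q L n patch refl) (trans (sym (g-2^q L n α refl)) (gα≈β _ 2^q<K))
    (no i≢)    → trans (g-≢2^q L n patch i≢) (patch-hit i≢)

g-open : ∀ L n → 1 ≤ L → (U : Cantor → Set) → Open U → Open (Image (g L n) U)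
g-open L n 1≤L U U-open β (α , α∈U , gα≈β) = K , λ β′ β≈β′ → lift β′ β≈β′
  where
  r = proj₁ (U-open α α∈U)
  K = r + suc (2 ^ q n)
  lift : ∀ β′ → Agree K β β′ → Image (g L n) U β′
  lift β′ β≈β′ with g-lift L n 1≤L α β′ K (m≤n+m _ r) (λ i i<K → trans (gα≈β i) (β≈β′ i i<K))
  ... | α′ , α≈α′ , gα′≈β′ = α′ , proj₂ (U-open α α∈U) α′ (Agree-≤ (m≤m+n r _) α≈α′) , gα′≈β′

g-image-clopen : ∀ L n → 1 ≤ L → Clopen (Image (g L n) (𝔻 L n))
g-image-clopen L n 1≤L = g-open L n 1≤L (𝔻 L n) (proj₁ (𝔻-clopen L n)) , closed
  where
  closed : Closed (Image (g L n) (𝔻 L n))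
  closed β β∉ = 𝔻-radius n , λ where
    β′ β≈β′ (α′ , α′∈𝔻 , gα′≈β′) →
      let α″ , α′≈α″ , gα″≈β = g-lift L n 1≤L α′ β (𝔻-radius n) (2^q<𝔻-radius n)
                                 (λ i i< → trans (gα′≈β′ i) (sym (β≈β′ i i<)))
      in β∉ (α″ , 𝔻-resp-Agree L n α′ α″ α′≈α″ α′∈𝔻 , gα″≈β)

oddᵇ : ℕ → Bool
oddᵇ zero    = false
oddᵇ (suc m) = not (oddᵇ m)

n<3^n : ∀ n → n < 3 ^ n
n<3^n n = <-≤-trans (n<2^n n) (^-monoˡ-≤ n (s≤s (s≤s z≤n)))

-- The point of 𝔻_n that extends t_n 0 and alternates along the positions 2 ^ q n * 3 ^ m.
module Alternating (n : ℕ) where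

  private
    m≤2^q*3^m : ∀ {m} → 1 ≤ m → m ≤ 2 ^ q n * 3 ^ m
    m≤2^q*3^m {m} _ = ≤-trans (<⇒≤ (n<3^n m)) (m≤n*m (3 ^ m) (2 ^ q n) {{m^n≢0 2 (q n)}})

  open Patch (λ m → 1 ≤? m) (λ m → 2 ^ q n * 3 ^ m) m≤2^q*3^m
             (λ eq → 3^-injective (2^n*-cancelˡ-≡ (q n) eq)) oddᵇ (nth (t0 n))
    renaming (patch to β)
    public

  β-t0 : ∀ i → i ≤ 2 ^ q n → β i ≡ nth (t0 n) i
  β-t0 i i≤ = patch-miss λ m 1≤m eq → <⇒≱ (2^q<2^q*3^m 1≤m) (subst (_≤ 2 ^ q n) (sym eq) i≤)
    where
    2^q<2^q*3^m : ∀ {m} → 1 ≤ m → 2 ^ q n < 2 ^ q n * 3 ^ m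
    2^q<2^q*3^m {m} 1≤m = subst (_< 2 ^ q n * 3 ^ m) (*-identityʳ (2 ^ q n))
      (*-monoʳ-< (2 ^ q n) {{m^n≢0 2 (q n)}} (^-monoʳ-< 3 (s≤s (s≤s z≤n)) 1≤m))

  β-3^ : ∀ m → β (2 ^ q n * 3 ^ m) ≡ oddᵇ m
  β-3^ zero    = trans (β-t0 _ (≤-reflexive (*-identityʳ (2 ^ q n))))
                       (nth-t0-padding n _ (≤-trans (length-ψ≤2^q n) (≤-reflexive (sym (*-identityʳ (2 ^ q n))))))
  β-3^ (suc m) = patch-hit {suc m} (s≤s z≤n)

  β∈𝔻 : ∀ L → 𝔻 L n β
  β∈𝔻 zero          = nth⇒domg n β β-t0
  β∈𝔻 (suc zero)    = nth⇒domg n β β-t0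
  β∈𝔻 (suc (suc L)) = nth⇒domg n β β-t0 ,
    λ m _ eq → b≢not-b (oddᵇ m) (trans (sym (β-3^ m)) (trans eq (β-3^ (suc m))))

nth-applyUpTo : ∀ α k {i} → i < k → nth (applyUpTo α k) i ≡ α i
nth-applyUpTo α (suc k) {zero}  _         = refl
nth-applyUpTo α (suc k) {suc i} (s≤s i<k) = nth-applyUpTo (α ∘ suc) k i<k

¬S-below : ∀ n {i} → i < 2 ^ q n → ¬ S n i
¬S-below n i<2^q (j , refl) = <⇒≱ i<2^q (m≤m*n (2 ^ q n) (suc j))

-- Near α, pick n with ψ n = α ↾ k; below k ≤ |ψ n| the map g_n only copies coordinates.
diagonal-in-closure : ∀ L α k → ∃ λ n → ∃ λ β → 𝔻 L n β × Agree k α β × Agree k α (g L n β)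
diagonal-in-closure L α k = n , β , β∈𝔻 L , α≈β , α≈gβ
  where
  n = proj₁ (ψ-surjective (applyUpTo α k))
  ψn≡α↾k = proj₂ (ψ-surjective (applyUpTo α k))
  open Alternating n
  k≡|ψn| : k ≡ length (ψ n)
  k≡|ψn| = sym (trans (cong length ψn≡α↾k) (length-applyUpTo α k))
  i<|ψn| : ∀ {i} → i < k → i < length (ψ n)
  i<|ψn| i<k = subst (_ <_) k≡|ψn| i<k
  α≈β : Agree k α β
  α≈β i i<k = sym (begin
    β i                 ≡⟨ β-t0 i (<⇒≤ (<-≤-trans (i<|ψn| i<k) (length-ψ≤2^q n))) ⟩
    nth (t0 n) i        ≡⟨ nth-t0-ψ n i (i<|ψn| i<k) ⟩
    nth (ψ n) i         ≡⟨ cong (λ t → nth t i) ψn≡α↾k ⟩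
    nth (applyUpTo α k) i ≡⟨ nth-applyUpTo α k i<k ⟩
    α i                 ∎)
    where open ≡-Reasoning
  α≈gβ : Agree k α (g L n β)
  α≈gβ i i<k = trans (α≈β i i<k) (sym (trans (g-≢2^q L n β (<⇒≢ i<2^q)) (cong β (θn-¬S L n (¬S-below n i<2^q)))))
    where
    i<2^q : i < 2 ^ q n
    i<2^q = <-≤-trans (i<|ψn| i<k) (length-ψ≤2^q n)

θ-gap : ℕ → ℕ → ℕ
θ-gap (suc zero) t = 2 * suc t
θ-gap _          t = 3 * t + 1

θ-gap-> : ∀ L t → t < θ-gap L t
θ-gap-> (suc zero)    t = m≤m+n (suc t) (suc t + 0)
θ-gap-> zero          t = subst (t <_) (+-comm 1 (3 * t)) (s≤s (m≤m+n t (t + (t + 0))))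
θ-gap-> (suc (suc L)) t = subst (t <_) (+-comm 1 (3 * t)) (s≤s (m≤m+n t (t + (t + 0))))

θ-gap-injective : ∀ L {t t′} → θ-gap L t ≡ θ-gap L t′ → t ≡ t′
θ-gap-injective (suc zero)    eq = suc-injective (*-cancelˡ-≡ _ _ 2 eq)
θ-gap-injective zero          eq = 3*-cancelˡ-≡ (+-cancelʳ-≡ 1 _ _ eq)
θ-gap-injective (suc (suc L)) eq = 3*-cancelˡ-≡ (+-cancelʳ-≡ 1 _ _ eq)

θ≢θ-gap : ∀ L t j → 1 ≤ L → θ L j ≢ θ-gap L t
θ≢θ-gap (suc zero)    t j _ eq = even≢odd (suc t) j (trans (sym eq) (+-comm (2 * j) 1))
θ≢θ-gap (suc (suc L)) t j _ eq = 3∤3n+1 t (subst (3 ∣_) eq (3∣θ L j))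

-- Flipping α₀ at the unread positions 2 ^ q n * θ-gap (r + i) beats the i-th point of any enumeration.
g-not-countable-to-one : ∀ L → 1 ≤ L → ∀ n (U : Cantor → Set) → Open U → Σ Cantor U
                       → ¬ (∀ β → Countable (λ α → U α × (g L n α ≈ β)))
g-not-countable-to-one L 1≤L n U U-open (α₀ , α₀∈U) countable =
  b≢not-b (e i (p i)) (trans (ei≈α′ (p i)) (patch-hit {i} tt))
  where
  r = proj₁ (U-open α₀ α₀∈U)
  e = proj₁ (countable (g L n α₀))

  p : ℕ → ℕ
  p i = 2 ^ q n * θ-gap L (r + i)

  r+i<p : ∀ i → r + i < p i
  r+i<p i = ≤-trans (θ-gap-> L (r + i)) (m≤n*m (θ-gap L (r + i)) (2 ^ q n) {{m^n≢0 2 (q n)}})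

  p-injective : ∀ {i i′} → p i ≡ p i′ → i ≡ i′
  p-injective eq = +-cancelˡ-≡ r _ _ (θ-gap-injective L (2^n*-cancelˡ-≡ (q n) eq))

  θn≢p : ∀ k i → θn L n k ≢ p i
  θn≢p k i eq with S? n k
  ... | yes (j , k≡) = θ≢θ-gap L (r + i) (suc j) 1≤L (2^n*-cancelˡ-≡ (q n) (trans (sym (θn-S L n j k≡)) eq))
  ... | no k∉S with θ-gap L (r + i) | θ-gap-> L (r + i)
  ...   | suc t | _ = k∉S (t , trans (sym (θn-¬S L n k∉S)) eq)

  open Patch {D = λ _ → ⊤} (λ _ → yes tt) p (λ {i} _ → ≤-trans (m≤n+m i r) (<⇒≤ (r+i<p i))) p-injective
             (λ i → not (e i (p i))) α₀
    renaming (patch to α′)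

  α₀≈α′ : Agree r α₀ α′
  α₀≈α′ x x<r = sym (patch-miss λ i _ p≡x → <-irrefl refl
    (<-trans (subst (_< r) (sym p≡x) x<r) (≤-trans (s≤s (m≤m+n r i)) (r+i<p i))))

  gα′≈gα₀ : g L n α′ ≈ g L n α₀
  gα′≈gα₀ k = g-cong L n α′ α₀ k λ _ → patch-miss λ i _ eq → θn≢p k i (sym eq)

  α′-enumerated = proj₂ (countable (g L n α₀)) α′ (proj₂ (U-open α₀ α₀∈U) α′ α₀≈α′ , gα′≈gα₀)
  i = proj₁ α′-enumerated
  ei≈α′ : e i ≈ α′
  ei≈α′ = proj₂ α′-enumerated

strongly-complex : ∀ L → 1 ≤ L → StronglyComplex (𝔻 L) (g L)
strongly-complex L 1≤L =
    perfect
  , 𝔻-clopen L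
  , (λ n → g-image-clopen L n 1≤L)
  , (λ n α _ k → g-modulus L n k , λ β _ → g-continuous L n α β k)
  , (λ n U U-open _ → g-open L n 1≤L U U-open)
  , (λ α n α∈𝔻 → g-no-fixpoint L n α (𝔻⇒domg L n α α∈𝔻))
  , diagonal-in-closure L
  , (λ n U U-open _ → g-not-countable-to-one L 1≤L n U U-open)

source : ℕ → List ℕ → ℕ → Maybe ℕ
source L []      k = just k
source L (n ∷ s) k with k ≟ 2 ^ q n
... | yes _ = nothing
... | no _  = source L s (θn L n k)

read : Cantor → Maybe ℕ → Bool
read α nothing  = true
read α (just y) = α y

gs-source : ∀ L s α k → gs L s α k ≡ read α (source L s k)
gs-source L []      α k = refl
gs-source L (n ∷ s) α k with k ≟ 2 ^ q n
... | yes _ = refl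
... | no _  = gs-source L s α (θn L n k)

source-≢ : ∀ L n s {k} → k ≢ 2 ^ q n → source L (n ∷ s) k ≡ source L s (θn L n k)
source-≢ L n s {k} k≢ with k ≟ 2 ^ q n
... | yes eq = contradiction eq k≢
... | no _   = refl

source-just : ∀ L n s {k y} → source L (n ∷ s) k ≡ just y → source L s (θn L n k) ≡ just y
source-just L n s {k} eq with k ≟ 2 ^ q n
source-just L n s () | yes _
... | no _ = eq

gs-∷ʳ : ∀ L u m α → gs L (u ∷ʳ m) α ≡ gs L u (g L m α)
gs-∷ʳ L []      m α = refl
gs-∷ʳ L (n ∷ u) m α = cong (g L n) (gs-∷ʳ L u m α)

length-∷ʳ : ∀ (u : List ℕ) m → length (u ∷ʳ m) ≡ suc (length u)
length-∷ʳ u m = trans (length-++ u) (+-comm (length u) 1)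

Linked-∷ʳ⇒All< : ∀ u {m} → Linked _<_ (u ∷ʳ m) → All (_< m) u
Linked-∷ʳ⇒All< []          _            = []
Linked-∷ʳ⇒All< (a ∷ [])    (a<m ∷ _)    = a<m ∷ []
Linked-∷ʳ⇒All< (a ∷ b ∷ u) (a<b ∷ b∷u↑) with Linked-∷ʳ⇒All< (b ∷ u) b∷u↑
... | b<m ∷ u<m = <-trans a<b b<m ∷ b<m ∷ u<m

Linked-∷ʳ⇒+length< : ∀ a u {m} → Linked _<_ (a ∷ u ∷ʳ m) → a + length u < m
Linked-∷ʳ⇒+length< a []      (a<m ∷ _)  = subst (_< _) (sym (+-identityʳ a)) a<m
Linked-∷ʳ⇒+length< a (b ∷ u) (a<b ∷ b↑) = begin-strict
  a + suc (length u)  ≡⟨ +-suc a (length u) ⟩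
  suc a + length u    ≤⟨ +-monoˡ-≤ (length u) a<b ⟩
  b + length u        <⟨ Linked-∷ʳ⇒+length< b u b↑ ⟩
  _                   ∎
  where open ≤-Reasoning

Linked-∷ʳ⇒length≤ : ∀ u {m} → Linked _<_ (u ∷ʳ m) → length u ≤ m
Linked-∷ʳ⇒length≤ []      _  = z≤n
Linked-∷ʳ⇒length≤ (a ∷ u) u↑ = ≤-<-trans (m≤n+m (length u) a) (Linked-∷ʳ⇒+length< a u u↑)

Linked-∷ʳ⇒head< : ∀ a u {m} → Linked _<_ (a ∷ u ∷ʳ m) → All (a <_) u
Linked-∷ʳ⇒head< a []      _          = []
Linked-∷ʳ⇒head< a (b ∷ u) (a<b ∷ b↑) = a<b ∷ All.map (<-trans a<b) (Linked-∷ʳ⇒head< b u b↑)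

S-2^q : ∀ n → S n (2 ^ q n)
S-2^q n = 0 , sym (*-identityʳ (2 ^ q n))

¬S-0 : ∀ n → ¬ S n 0
¬S-0 n (j , eq) = 2^q*[1+j]≢0 n j (sym eq)

S-q-anti : ∀ a b {x} → q a ≤ q b → S b x → S a x
S-q-anti a b {x} qa≤qb (j , refl) = pred k , (begin
  2 ^ q b * suc j                  ≡⟨ cong (λ e → 2 ^ e * suc j) (sym (m+[n∸m]≡n qa≤qb)) ⟩
  2 ^ (q a + d) * suc j            ≡⟨ cong (_* suc j) (^-distribˡ-+-* 2 (q a) d) ⟩
  2 ^ q a * 2 ^ d * suc j          ≡⟨ *-assoc (2 ^ q a) (2 ^ d) (suc j) ⟩
  2 ^ q a * k                      ≡⟨ cong (2 ^ q a *_) (sym (suc-pred k {{k≢0}})) ⟩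
  2 ^ q a * suc (pred k)           ∎)
  where
  open ≡-Reasoning
  d = q b ∸ q a
  k = 2 ^ d * suc j
  k≢0 : NonZero k
  k≢0 = m*n≢0 (2 ^ d) (suc j) {{m^n≢0 2 d}}

¬S-≤ : ∀ a b {x} → a ≤ b → ¬ S a x → ¬ S b x
¬S-≤ a b a≤b x∉Sa x∈Sb = x∉Sa (S-q-anti a b (q-monoʳ-≤ a≤b) x∈Sb)

¬S-3* : ∀ n {x} → ¬ S n x → ¬ S n (3 * x)
¬S-3* n {x} x∉S (t , 3x≡) with 3∣2^n*m⇒3∣m (q n) (suc t) (divides x (trans (sym 3x≡) (*-comm 3 x)))
... | divides (suc c) 1+t≡ = x∉S (c , 3*-cancelˡ-≡ (begin
  3 * x                  ≡⟨ 3x≡ ⟩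
  2 ^ q n * suc t        ≡⟨ cong (2 ^ q n *_) 1+t≡ ⟩
  2 ^ q n * (suc c * 3)  ≡⟨ swap (2 ^ q n) (suc c) ⟩
  3 * (2 ^ q n * suc c)  ∎))
  where
  open ≡-Reasoning
  swap : ∀ a b → a * (b * 3) ≡ 3 * (a * b)
  swap = solve-∀

2^q-split : ∀ {a m} → a < m → ∃ λ d → 2 ^ q m ≡ 2 ^ q a * 2 ^ suc d
2^q-split {a} {m} a<m = d , trans (cong (2 ^_) (sym qm≡)) (^-distribˡ-+-* 2 (q a) (suc d))
  where
  d = q m ∸ suc (q a)
  qm≡ : q a + suc d ≡ q m
  qm≡ = trans (+-suc (q a) d) (m+[n∸m]≡n (q-monoʳ-< a<m))

¬S-odd : ∀ {a m y z} → a < m → y ≡ 2 ^ q a * z → 2 ∤ z → ¬ S m y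
¬S-odd {a} {m} {y} {z} a<m y≡ 2∤z (t , y≡′) with 2^q-split a<m
... | d , 2^qm≡ = 2∤z (divides (2 ^ d * suc t) (2^n*-cancelˡ-≡ (q a) (begin
  2 ^ q a * z                         ≡⟨ sym y≡ ⟩
  y                                   ≡⟨ y≡′ ⟩
  2 ^ q m * suc t                     ≡⟨ cong (_* suc t) 2^qm≡ ⟩
  2 ^ q a * (2 * 2 ^ d) * suc t       ≡⟨ shuffle (2 ^ q a) (2 ^ d) (suc t) ⟩
  2 ^ q a * (2 ^ d * suc t * 2)       ∎)))
  where
  open ≡-Reasoning
  shuffle : ∀ a b c → a * (2 * b) * c ≡ a * (b * c * 2)
  shuffle = solve-∀

-- (b) Short composites differ

2^p*3^l∉M : ∀ L p l → l ≤ L → ¬ M (2 + L) (2 ^ p * 3 ^ l)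
2^p*3^l∉M L p l l≤L (k , _ , k∉P , eq) =
  let p′ , _  , 3k≡ = 2^n*m≡2^p*3^l⇒p≡n+p′ 31 (3 * k) p l (sym (trans eq (swap k (2 ^ 31))))
      l′ , l≡ , k≡  = 3*m≡2^p*3^l⇒l≡1+l′ k p′ l 3k≡
  in k∉P (p′ , l′ , subst (_≤ L) l≡ l≤L , sym k≡)
  where
  swap : ∀ k a → k * (a * 3) ≡ a * (3 * k)
  swap = solve-∀

θ-2^[1+d]*3^i : ∀ L d i → i ≤ L → θ (2 + L) (2 ^ suc d * 3 ^ i) ≡ 3 * (2 ^ suc d * 3 ^ i)
θ-2^[1+d]*3^i L d i i≤L with θ-view L (2 ^ suc d * 3 ^ i)
... | in-M J∈M _           = contradiction J∈M (2^p*3^l∉M L (suc d) i i≤L)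
... | in-M+1 i₀ i₀∈M J≡ _  = contradiction (∣m⇒∣m*n (3 ^ i) (m∣m*n (2 ^ d))) (M+1⇒2∤ {2 + L} (i₀ , i₀∈M , J≡))
... | other _ _ eq         = eq

θ-3^ : ∀ L r → 1 ≤ r → θ (2 + L) (3 ^ r) ≡ 3 * 3 ^ r
θ-3^ L (suc r) _ with θ-view L (3 ^ suc r)
... | in-M 3^r∈M _           = contradiction (M⇒2∣ {2 + L} 3^r∈M) (2∤3^n (suc r))
... | in-M+1 i₀ i₀∈M 3^r≡ _  = contradiction (m∣m*n (3 ^ r)) (M+1⇒3∤ {2 + L} (i₀ , i₀∈M , 3^r≡))
... | other _ _ eq           = eq

-- For a < m, 2 ^ q m * 3 ^ i = 2 ^ q a * J with J even and, as i ≤ L, J ∉ M_L; so θ J = 3 J.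
source-2^q*3^ : ∀ L m w i → All (_< m) w → i + length w ≤ suc L
              → source (2 + L) w (2 ^ q m * 3 ^ i) ≡ just (2 ^ q m * 3 ^ (i + length w))
source-2^q*3^ L m []      i _           _ = cong (λ e → just (2 ^ q m * 3 ^ e)) (sym (+-identityʳ i))
source-2^q*3^ L m (a ∷ w) i (a<m ∷ w<m) i+|a∷w|≤ = begin
  source (2 + L) (a ∷ w) (2 ^ q m * 3 ^ i)   ≡⟨ source-≢ (2 + L) a w x≢2^qa ⟩
  source (2 + L) w (θn (2 + L) a (2 ^ q m * 3 ^ i))
                                             ≡⟨ cong (source (2 + L) w) θn-step ⟩
  source (2 + L) w (2 ^ q m * 3 ^ suc i)     ≡⟨ source-2^q*3^ L m w (suc i) w<m (subst (_≤ suc L) (+-suc i _) i+|a∷w|≤) ⟩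
  just (2 ^ q m * 3 ^ (suc i + length w))    ≡⟨ cong (λ e → just (2 ^ q m * 3 ^ e)) (sym (+-suc i (length w))) ⟩
  just (2 ^ q m * 3 ^ (i + length (a ∷ w)))  ∎
  where
  open ≡-Reasoning
  i≤L : i ≤ L
  i≤L = ≤-pred (≤-trans (s≤s (m≤m+n i (length w))) (subst (_≤ suc L) (+-suc i (length w)) i+|a∷w|≤))
  x≢2^qa : 2 ^ q m * 3 ^ i ≢ 2 ^ q a
  x≢2^qa eq = <⇒≢ (<-≤-trans (^-monoʳ-< 2 (s≤s (s≤s z≤n)) (q-monoʳ-< a<m)) (m≤m*n (2 ^ q m) (3 ^ i) {{m^n≢0 3 i}})) (sym eq)
  d = proj₁ (2^q-split a<m)
  2^qm≡ = proj₂ (2^q-split a<m)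
  reassoc : ∀ a b c → a * (3 * (b * c)) ≡ a * b * (3 * c)
  reassoc = solve-∀
  θn-step : θn (2 + L) a (2 ^ q m * 3 ^ i) ≡ 2 ^ q m * 3 ^ suc i
  θn-step = begin
    θn (2 + L) a (2 ^ q m * 3 ^ i)           ≡⟨ θn-2^q* (2 + L) a (1≤2^a*3^b (suc d) i) (trans (cong (_* 3 ^ i) 2^qm≡) (*-assoc (2 ^ q a) _ (3 ^ i))) ⟩
    2 ^ q a * θ (2 + L) (2 ^ suc d * 3 ^ i)  ≡⟨ cong (2 ^ q a *_) (θ-2^[1+d]*3^i L d i i≤L) ⟩
    2 ^ q a * (3 * (2 ^ suc d * 3 ^ i))      ≡⟨ reassoc (2 ^ q a) (2 ^ suc d) (3 ^ i) ⟩
    2 ^ q a * 2 ^ suc d * 3 ^ suc i          ≡⟨ cong (_* 3 ^ suc i) (sym 2^qm≡) ⟩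
    2 ^ q m * 3 ^ suc i                      ∎

-- Started at 2 ^ q m, g_u reaches 2 ^ q m * 3 ^ |u|, where g_{u ∷ʳ m} reads one power of 3 further.
gs-∷ʳ-≉ : ∀ L u m α → Linked _<_ (u ∷ʳ m) → 1 ≤ length u → length u ≤ suc L → 𝔻 (2 + L) m α
        → ¬ (gs (2 + L) (u ∷ʳ m) α ≈ gs (2 + L) u α)
gs-∷ʳ-≉ L u m α u↑ 1≤r r≤ (_ , alternates) gs≈ =
  alternates r (Linked-∷ʳ⇒length≤ u u↑) (begin
    α y                               ≡⟨ sym (cong (read α) source≡) ⟩
    read α (source (2 + L) u k₀)      ≡⟨ sym (gs-source (2 + L) u α k₀) ⟩
    gs (2 + L) u α k₀                 ≡⟨ sym (gs≈ k₀) ⟩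
    gs (2 + L) (u ∷ʳ m) α k₀          ≡⟨ cong (λ f → f k₀) (gs-∷ʳ (2 + L) u m α) ⟩
    gs (2 + L) u (g (2 + L) m α) k₀   ≡⟨ gs-source (2 + L) u _ k₀ ⟩
    read (g (2 + L) m α) (source (2 + L) u k₀)
                                      ≡⟨ cong (read (g (2 + L) m α)) source≡ ⟩
    g (2 + L) m α y                   ≡⟨ g-≢2^q (2 + L) m α y≢2^q ⟩
    α (θn (2 + L) m y)                ≡⟨ cong α (θn-2^q* (2 + L) m (m^n>0 3 r) refl) ⟩
    α (2 ^ q m * θ (2 + L) (3 ^ r))   ≡⟨ cong (λ j → α (2 ^ q m * j)) (θ-3^ L r 1≤r) ⟩
    α (2 ^ q m * 3 ^ suc r)           ∎)
  where
  open ≡-Reasoning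
  r = length u
  k₀ = 2 ^ q m * 3 ^ 0
  y = 2 ^ q m * 3 ^ r
  source≡ : source (2 + L) u k₀ ≡ just y
  source≡ = source-2^q*3^ L m u 0 (Linked-∷ʳ⇒All< u u↑) r≤
  y≢2^q : y ≢ 2 ^ q m
  y≢2^q eq = <⇒≢ (^-monoʳ-< 3 (s≤s (s≤s z≤n)) 1≤r)
                 (sym (2^n*-cancelˡ-≡ (q m) (trans eq (sym (*-identityʳ (2 ^ q m))))))

-- (c) Long composites agree

gs-∷ʳ-≈ : ∀ L u m α → (∀ k {y} → source L u k ≡ just y → ¬ S m y) → gs L (u ∷ʳ m) α ≈ gs L u α
gs-∷ʳ-≈ L u m α avoids k = begin
  gs L (u ∷ʳ m) α k                       ≡⟨ cong (λ f → f k) (gs-∷ʳ L u m α) ⟩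
  gs L u (g L m α) k                      ≡⟨ gs-source L u (g L m α) k ⟩
  read (g L m α) (source L u k)           ≡⟨ read-g (source L u k) refl ⟩
  read α (source L u k)                   ≡⟨ sym (gs-source L u α k) ⟩
  gs L u α k                              ∎
  where
  open ≡-Reasoning
  read-g : ∀ r → source L u k ≡ r → read (g L m α) r ≡ read α r
  read-g nothing  _  = refl
  read-g (just y) eq = trans (g-≢2^q L m α y≢2^q) (cong α (θn-¬S L m y∉S))
    where
    y∉S = avoids k eq
    y≢2^q : y ≢ 2 ^ q m
    y≢2^q refl = y∉S (S-2^q m)

θn₁-avoids-S : ∀ {a m} → a < m → ∀ k → ¬ S m (θn 1 a k)
θn₁-avoids-S {a} {m} a<m k with S? a k
... | no k∉Sa      = subst (λ x → ¬ S m x) (sym (θn-¬S 1 a k∉Sa)) (¬S-≤ a m (<⇒≤ a<m) k∉Sa)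
... | yes (j , k≡) = ¬S-odd a<m (θn-S 1 a j k≡) (2∤2n+1 (suc j))

q-gap : ∀ {b m} → 3 ≤ m → b < m → q b + 31 ≤ q m
q-gap {b} {suc m} (s≤s 2≤m) (s≤s b≤m) = begin
  q b + 31                  ≤⟨ +-monoˡ-≤ 31 (q-monoʳ-≤ b≤m) ⟩
  x + 31                    ≤⟨ +-mono-≤ (<⇒≤ (n<2^n x)) (≤-trans (n≤1+n 31) (^-monoʳ-≤ 2 5≤x)) ⟩
  2 ^ x + 2 ^ x             ≤⟨ +-monoʳ-≤ (2 ^ x) (m≤m+n (2 ^ x) (2 ^ x + 0)) ⟩
  3 * 2 ^ x                 ∎
  where
  open ≤-Reasoning
  x = q m
  5≤x : 5 ≤ x
  5≤x = ≤-trans (from-yes (5 ≤? q 2)) (q-monoʳ-≤ 2≤m)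

∉M⇒3-exponent< : ∀ L d i s → 1 ≤ s → ¬ M (2 + L) (2 ^ 31 * 2 ^ d * (3 ^ suc i * s)) → i < L
∉M⇒3-exponent< L d i s 1≤s J∉M = bound (P? (2 + L) k)
  where
  k = 2 ^ d * (3 ^ i * s)
  1≤k : 1 ≤ k
  1≤k = *-mono-≤ (m^n>0 2 d) (*-mono-≤ (m^n>0 3 i) 1≤s)
  J≡ : 2 ^ 31 * 2 ^ d * (3 ^ suc i * s) ≡ k * c31
  J≡ = reorder (2 ^ 31) (2 ^ d) (3 ^ i) s
    where
    reorder : ∀ A D I s → A * D * (3 * I * s) ≡ D * (I * s) * (A * 3)
    reorder = solve-∀
  swap : ∀ D I s → I * (D * s) ≡ D * (I * s)
  swap = solve-∀
  bound : Dec (P (2 + L) k) → i < L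
  bound (yes (p , l , l<L , 2^p3^l≡k)) =
    ≤-<-trans (3^n*m≡2^p*3^l⇒n≤l i (2 ^ d * s) p l (trans (swap (2 ^ d) (3 ^ i) s) (sym 2^p3^l≡k))) l<L
  bound (no k∉P) = contradiction (k , 1≤k , k∉P , J≡) J∉M

-- The gap of 31 makes each argument 2 ^ (q m - q b) * 3 ^ i * s of θ a multiple of 2 ^ 31 * 3, as in M_L;
-- so along g_b the exponent i can grow only while i ≤ L, beyond that θ swaps into an odd value.
module Climb (L m : ℕ) (gap : ∀ {b} → b < m → q b + 31 ≤ q m) where

  -- Either no remaining g_b acts on x, or 3 ∣ x keeps θ away from M_L + 1.
  Safe : List ℕ → ℕ → Set
  Safe w x = ¬ S m x × (All (λ b → ¬ S b x) w ⊎ 3 ∣ x)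

  safe-from-M : ∀ {b w x J} → b < m → x ≡ 2 ^ q b * J → M (2 + L) J → θ (2 + L) J ≡ 3 * (J + 1)
              → Safe w (θn (2 + L) b x)
  safe-from-M {b} {w} {x} {J} b<m x≡ J∈M θJ≡ =
    ¬S-odd b<m θx≡ (M+1⇒2∤ {2 + L} (J , J∈M , refl) ∘ 2∣3*m⇒2∣m) ,
    inj₂ (subst (3 ∣_) (sym θx≡) (∣n⇒∣m*n (2 ^ q b) (m∣m*n (J + 1))))
    where
    θx≡ : θn (2 + L) b x ≡ 2 ^ q b * (3 * (J + 1))
    θx≡ = trans (θn-2^q* (2 + L) b (M⇒≥1 {2 + L} J∈M) x≡) (cong (2 ^ q b *_) θJ≡)

  safe-step : ∀ {b w x} → b < m → Safe (b ∷ w) x → Safe w (θn (2 + L) b x)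
  safe-step {b} {w} {x} b<m (x∉Sm , rest) with S? b x
  ... | no x∉Sb = subst (Safe w) (sym (θn-¬S (2 + L) b x∉Sb)) (x∉Sm , map₁ All.tail rest)
  ... | yes (j , x≡) = step (θ-view L (suc j))
    where
    3∣x : 3 ∣ x
    3∣x = case rest of λ where
      (inj₁ (x∉Sb ∷ _)) → contradiction (j , x≡) x∉Sb
      (inj₂ 3∣x)        → 3∣x
    step : ΘView (2 + L) (suc j) → Safe w (θn (2 + L) b x)
    step (in-M J∈M θJ≡)          = safe-from-M b<m x≡ J∈M θJ≡
    step (in-M+1 i i∈M J≡ _)     = contradiction (3∣2^n*m⇒3∣m (q b) (suc j) (subst (3 ∣_) x≡ 3∣x))
                                                 (M+1⇒3∤ {2 + L} (i , i∈M , J≡))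
    step (other _ _ θJ≡) = subst (Safe w) (sym θx≡3x) (¬S-3* m x∉Sm , inj₂ (m∣m*n x))
      where
      reassoc : ∀ a j → a * (3 * j) ≡ 3 * (a * j)
      reassoc = solve-∀
      θx≡3x : θn (2 + L) b x ≡ 3 * x
      θx≡3x = trans (θn-S (2 + L) b j x≡)
                (trans (cong (2 ^ q b *_) θJ≡) (trans (reassoc (2 ^ q b) (suc j)) (cong (3 *_) (sym x≡))))

  safe-run : ∀ w {x y} → All (_< m) w → Safe w x → source (2 + L) w x ≡ just y → ¬ S m y
  safe-run []      _           (x∉Sm , _) refl = x∉Sm
  safe-run (b ∷ w) (b<m ∷ w<m) safe       eq   =
    safe-run w w<m (safe-step b<m safe) (source-just (2 + L) b w eq)

  climb-step : ∀ {b w i s x} → b < m → x ≡ 2 ^ q m * (3 ^ suc i * s)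
             → Safe w (θn (2 + L) b x) ⊎ (i < L × θn (2 + L) b x ≡ 2 ^ q m * (3 ^ suc (suc i) * s))
  climb-step {b} {w} {i} {zero} {x} _ x≡ = inj₁ (subst (Safe w) (sym θx≡0) (¬S-0 m , inj₂ (divides 0 refl)))
    where
    x≡0 : x ≡ 0
    x≡0 = trans x≡ (trans (cong (2 ^ q m *_) (*-zeroʳ (3 ^ suc i))) (*-zeroʳ (2 ^ q m)))
    θx≡0 : θn (2 + L) b x ≡ 0
    θx≡0 = trans (cong (θn (2 + L) b) x≡0) (θn-¬S (2 + L) b (¬S-0 b))
  climb-step {b} {w} {i} {s@(suc _)} {x} b<m x≡ = step (θ-view L J)
    where
    d = q m ∸ (q b + 31)
    W = 2 ^ 31 * 2 ^ d
    J = W * (3 ^ suc i * s)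
    2^qm≡ : 2 ^ q m ≡ 2 ^ q b * W
    2^qm≡ = begin
      2 ^ q m                    ≡⟨ cong (2 ^_) (sym (m+[n∸m]≡n (gap b<m))) ⟩
      2 ^ (q b + 31 + d)         ≡⟨ ^-distribˡ-+-* 2 (q b + 31) d ⟩
      2 ^ (q b + 31) * 2 ^ d     ≡⟨ cong (_* 2 ^ d) (^-distribˡ-+-* 2 (q b) 31) ⟩
      2 ^ q b * 2 ^ 31 * 2 ^ d   ≡⟨ *-assoc (2 ^ q b) (2 ^ 31) (2 ^ d) ⟩
      2 ^ q b * W                ∎
      where open ≡-Reasoning
    x≡′ : x ≡ 2 ^ q b * J
    x≡′ = trans x≡ (trans (cong (_* (3 ^ suc i * s)) 2^qm≡) (*-assoc (2 ^ q b) W _))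
    3∣J : 3 ∣ J
    3∣J = ∣n⇒∣m*n W (∣m⇒∣m*n s (m∣m*n (3 ^ i)))
    reassoc : ∀ a w t s → a * (3 * (w * (3 * t * s))) ≡ a * w * (3 * (3 * t) * s)
    reassoc = solve-∀
    step : ΘView (2 + L) J → Safe w (θn (2 + L) b x) ⊎ (i < L × θn (2 + L) b x ≡ 2 ^ q m * (3 ^ suc (suc i) * s))
    step (in-M J∈M θJ≡)      = inj₁ (safe-from-M b<m x≡′ J∈M θJ≡)
    step (in-M+1 i₀ i₀∈M J≡ _) = contradiction 3∣J (M+1⇒3∤ {2 + L} (i₀ , i₀∈M , J≡))
    step (other J∉M _ θJ≡)   = inj₂ (∉M⇒3-exponent< L d i s (s≤s z≤n) J∉M , (begin
      θn (2 + L) b x                  ≡⟨ θn-2^q* (2 + L) b (1≤W*[3^i*s]) x≡′ ⟩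
      2 ^ q b * θ (2 + L) J           ≡⟨ cong (2 ^ q b *_) θJ≡ ⟩
      2 ^ q b * (3 * J)               ≡⟨ reassoc (2 ^ q b) W (3 ^ i) s ⟩
      2 ^ q b * W * (3 ^ suc (suc i) * s) ≡⟨ cong (_* (3 ^ suc (suc i) * s)) (sym 2^qm≡) ⟩
      2 ^ q m * (3 ^ suc (suc i) * s) ∎))
      where
      open ≡-Reasoning
      1≤W*[3^i*s] : 1 ≤ J
      1≤W*[3^i*s] = *-mono-≤ (*-mono-≤ (m^n>0 2 31) (m^n>0 2 d)) (*-mono-≤ (m^n>0 3 (suc i)) (s≤s z≤n))

  climb-run : ∀ b w {i s x y} → All (_< m) (b ∷ w) → suc i + length (b ∷ w) ≡ 2 + L
            → x ≡ 2 ^ q m * (3 ^ suc i * s) → source (2 + L) (b ∷ w) x ≡ just y → ¬ S m y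
  climb-run b [] {i} {s} (b<m ∷ []) len x≡ eq = case climb-step {w = []} {i} {s} b<m x≡ of λ where
    (inj₁ safe)      → safe-run [] [] safe (source-just (2 + L) b [] eq)
    (inj₂ (i<L , _)) → contradiction (suc-injective (trans (+-comm 1 i) (suc-injective len))) (<⇒≢ i<L)
  climb-run b (b′ ∷ w) {i} {s} (b<m ∷ w<m) len x≡ eq = case climb-step {i = i} {s} b<m x≡ of λ where
    (inj₁ safe)      → safe-run (b′ ∷ w) w<m safe (source-just (2 + L) b _ eq)
    (inj₂ (_ , θx≡)) → climb-run b′ w {suc i} {s} w<m (trans (sym (+-suc (suc i) (length (b′ ∷ w)))) len) θx≡
                                 (source-just (2 + L) b _ eq)

  source-avoids-S : ∀ u {k y} → Linked _<_ (u ∷ʳ m) → length u ≡ 2 + L → source (2 + L) u k ≡ just y → ¬ S m y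
  source-avoids-S (b ∷ b′ ∷ w) {k} u↑ len eq with Linked-∷ʳ⇒All< (b ∷ b′ ∷ w) u↑ | S? b k
  ... | u<m@(b<m ∷ w<m) | no k∉Sb =
    safe-run (b ∷ b′ ∷ w) u<m (¬S-≤ b m (<⇒≤ b<m) k∉Sb ,
      inj₁ (k∉Sb ∷ All.map (λ b<c → ¬S-≤ b _ (<⇒≤ b<c) k∉Sb) (Linked-∷ʳ⇒head< b (b′ ∷ w) u↑))) eq
  ... | b<m ∷ w<m | yes (j , k≡) = continue (S? m (θn (2 + L) b k))
    where
    3∣θk : 3 ∣ θn (2 + L) b k
    3∣θk = subst (3 ∣_) (sym (θn-S (2 + L) b j k≡)) (∣n⇒∣m*n (2 ^ q b) (3∣θ L (suc j)))
    continue : Dec (S m (θn (2 + L) b k)) → ¬ S m _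
    continue (no θk∉Sm)      = safe-run (b′ ∷ w) w<m (θk∉Sm , inj₂ 3∣θk) (source-just (2 + L) b _ eq)
    continue (yes (t , θk≡)) with 3∣2^n*m⇒3∣m (q m) (suc t) (subst (3 ∣_) θk≡ 3∣θk)
    ... | divides c 1+t≡ = climb-run b′ w {0} {c} w<m len
            (trans θk≡ (cong (2 ^ q m *_) (trans 1+t≡ (trans (*-comm c 3) (cong (_* c) (sym (*-identityʳ 3)))))))
            (source-just (2 + L) b _ eq)

length-∷ʳ≡+1 : ∀ (u : List ℕ) m L → length (u ∷ʳ m) ≡ L + 1 → length u ≡ L
length-∷ʳ≡+1 u m L len = suc-injective (trans (sym (length-∷ʳ u m)) (trans len (+-comm L 1)))

short-increasing : ∀ u {m} → Linked _<_ (u ∷ʳ m) → 2 ≤ length u → m ≤ 2 → u ≡ 0 ∷ 1 ∷ [] × m ≡ 2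
short-increasing (a ∷ b ∷ []) {m} (a<b ∷ b<m ∷ [-]) _ m≤2 = cong₂ (λ a b → a ∷ b ∷ []) a≡0 b≡1 , m≡2
  where
  b≡1 : b ≡ 1
  b≡1 = ≤-antisym (≤-pred (≤-trans b<m m≤2)) (≤-trans (s≤s z≤n) a<b)
  a≡0 : a ≡ 0
  a≡0 = n<1⇒n≡0 (subst (a <_) b≡1 a<b)
  m≡2 : m ≡ 2
  m≡2 = ≤-antisym m≤2 (subst (_< m) b≡1 b<m)
short-increasing (_ ∷ []) _ (s≤s ()) _
short-increasing (a ∷ b ∷ c ∷ u) u↑ _ m≤2 =
  contradiction (≤-trans (Linked-∷ʳ⇒length≤ (a ∷ b ∷ c ∷ u) u↑) m≤2) (λ { (s≤s (s≤s ())) })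

short-composites-differ : ∀ L (u : List ℕ) (m : ℕ) (α : Cantor) → Linked _<_ (u ∷ʳ m)
                        → 2 ≤ length (u ∷ʳ m) → length (u ∷ʳ m) ≤ L
                        → 𝔻 L m α → ¬ (gs L (u ∷ʳ m) α ≈ gs L u α)
short-composites-differ (suc (suc L)) u m α u↑ 2≤ ≤L =
  gs-∷ʳ-≉ L u m α u↑ (≤-pred (subst (2 ≤_) (length-∷ʳ u m) 2≤)) (≤-pred (subst (_≤ 2 + L) (length-∷ʳ u m) ≤L))
short-composites-differ zero       u m α _ 2≤ ≤L = contradiction (≤-trans 2≤ ≤L) λ ()
short-composites-differ (suc zero) u m α _ 2≤ ≤L = contradiction (≤-trans 2≤ ≤L) λ { (s≤s ()) }

-- When m ≤ 2 the only candidate is s = (0, 1, 2), and then g_s and g_{s⁻} are never both defined: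
-- t_2 0 starts with 1 while t_1 0 starts with 0.
long-composites-agree : ∀ L → 1 ≤ L → (u : List ℕ) (m : ℕ) (α : Cantor) → Linked _<_ (u ∷ʳ m)
                      → length (u ∷ʳ m) ≡ L + 1
                      → Defined L (u ∷ʳ m) α → Defined L u α
                      → gs L (u ∷ʳ m) α ≈ gs L u α
long-composites-agree (suc zero) _ (a ∷ []) m α u↑ _ _ _ =
  gs-∷ʳ-≈ 1 (a ∷ []) m α λ k eq →
    subst (λ y → ¬ S m y) (just-injective (source-just 1 a [] eq)) (θn₁-avoids-S (All.head (Linked-∷ʳ⇒All< (a ∷ []) u↑)) k)
long-composites-agree (suc zero) _ [] m α _ () _ _
long-composites-agree (suc zero) _ (a ∷ b ∷ u) m α _ len _ _ with length-∷ʳ≡+1 (a ∷ b ∷ u) m 1 len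
... | ()
long-composites-agree (suc (suc L)) _ u m α u↑ len defined defined⁻ with 3 ≤? m
... | yes 3≤m = gs-∷ʳ-≈ (2 + L) u m α λ k → Climb.source-avoids-S L m (q-gap 3≤m) u u↑ |u|≡
  where
  |u|≡ = length-∷ʳ≡+1 u m (2 + L) len
... | no 3≰m with short-increasing u u↑ (subst (2 ≤_) (sym (length-∷ʳ≡+1 u m (2 + L) len)) (s≤s (s≤s z≤n))) (≤-pred (≰⇒> 3≰m))
...   | refl , refl with trans (sym (proj₁ (proj₂ (proj₁ (proj₁ defined))))) (proj₁ (proj₂ (proj₁ defined⁻)))
...     | ()

lemma5p2 : (L : ℕ) → 1 ≤ L →
    StronglyComplex (𝔻 L) (g L)
  × ((u : List ℕ) (m : ℕ) (α : Cantor) → Linked _<_ (u ∷ʳ m)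
       → 2 ≤ length (u ∷ʳ m) → length (u ∷ʳ m) ≤ L
       → 𝔻 L m α → Defined L (u ∷ʳ m) α → Defined L u α
       → ¬ (gs L (u ∷ʳ m) α ≈ gs L u α))
  × ((u : List ℕ) (m : ℕ) (α : Cantor) → Linked _<_ (u ∷ʳ m)
       → length (u ∷ʳ m) ≡ L + 1
       → Defined L (u ∷ʳ m) α → Defined L u α
       → gs L (u ∷ʳ m) α ≈ gs L u α)
lemma5p2 L 1≤L =
    strongly-complex L 1≤L
  , (λ u m α u↑ 2≤ ≤L α∈𝔻 _ _ → short-composites-differ L u m α u↑ 2≤ ≤L α∈𝔻)
  , long-composites-agree L 1≤L
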